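{- Let $G$ be a finite simple graph of order $2n$ with a perfect matching $M$ such that $f(G,M)=k$, where $0\leq k\leq n-1$. Then there exists an edge $uv\in M$ such that $d_G(u)+d_G(v)\geq \frac{2n}{n-k}$. Moreover, if $\max_{xy\in M}\big(d_G(x)+d_G(y)\big)=\frac{2n}{n-k}$, then $(n-k)$ divides $n$.
   Context: For a graph $G$ with a perfect matching $M$, a subset $S\subseteq M$ is a forcing set of $M$ if $S$ is contained in no perfect matching of $G$ other than $M$; $f(G,M)$ is the minimum size of a forcing set of $M$. $d_G(v)$ denotes the degree of $v$ in $G$. -}

module Defs where

open import Data.Nat using (ℕ; _*_; _+_; _≤_)
open import Data.Bool using (Bool; true; false)
open import Data.Fin using (Fin)
open import Data.Fin.Subset using (Subset; _∈_; ∣_∣)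
open import Data.Vec using (tabulate)
open import Data.Product using (Σ; _×_)
open import Relation.Binary.PropositionalEquality using (_≡_; _≢_)

record Graph (m : ℕ) : Set where
  field
    adj   : Fin m → Fin m → Bool
    sym   : ∀ u v → adj u v ≡ adj v u
    irrefl : ∀ v → adj v v ≡ false

open Graph public

deg : ∀ {m} → Graph m → Fin m → ℕ
deg G v = ∣ tabulate (adj G v) ∣

-- A perfect matching, represented by the partner map: a fixed-point-free
-- involution sending each vertex to an adjacent vertex.  The edges of M
-- are the pairs {v , partner v}.
record PerfectMatching {m : ℕ} (G : Graph m) : Set where
  field
    partner     : Fin m → Fin m
    involutive  : ∀ v → partner (partner v) ≡ v
    no-fixed    : ∀ v → partner v ≢ v
    adjacent    : ∀ v → adj G v (partner v) ≡ true

open PerfectMatching public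

-- A subset S of the edges of M, represented by the set of vertices it covers
-- (a vertex subset closed under the partner map of M).
-- The number of edges of S is  ∣ S ∣ / 2.
IsEdgeSubsetOf : ∀ {m} {G : Graph m} → PerfectMatching G → Subset m → Set
IsEdgeSubsetOf M S = ∀ v → v ∈ S → partner M v ∈ S

-- S is a set of edges of M (given as the covered vertices), and every edge
-- {v , partner M v} of S is also an edge of M'.
ContainedIn : ∀ {m} {G : Graph m} → PerfectMatching G → Subset m → PerfectMatching G → Set
ContainedIn M S M' = ∀ v → v ∈ S → partner M' v ≡ partner M v

IsForcingSet : ∀ {m} {G : Graph m} → PerfectMatching G → Subset m → Set
IsForcingSet {G = G} M S =
  IsEdgeSubsetOf M S ×
  ((M' : PerfectMatching G) → ContainedIn M S M' → ∀ v → partner M' v ≡ partner M v)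

-- f(G,M) = k : there is a forcing set with k edges, and every forcing set
-- has at least k edges (edge count of S is ∣ S ∣ / 2).
ForcingNumber≡ : ∀ {m} {G : Graph m} → PerfectMatching G → ℕ → Set
ForcingNumber≡ M k =
  Σ (Subset _) (λ S → IsForcingSet M S × ∣ S ∣ ≡ 2 * k) ×
  (∀ S → IsForcingSet M S → 2 * k ≤ ∣ S ∣)

-- Let f be the largest value of min(d(x), d(y)) over the edges xy of M.  A greedy
-- process removes M-edges from a σ-closed set R of unsettled vertices (σ = partner):
-- pick u ∈ R with d(u) ≤ f, let T be the edges of M inside R that meet N(u), put every
-- edge of T except uσ(u) into the forcing set and delete T from R.  Then u can only be
-- matched to σ(u), and T has at most 2 d(u) ≤ 2f vertices.  After t rounds all 2n
-- vertices are settled, so 2n ≤ 2 t f, and the forcing set has at most 2n - 2t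
-- vertices, so k ≤ n - t.  Hence n ≤ (n - k) f ≤ (n - k)(d(w) + d(σ w)) / 2 at an edge
-- w σ(w) attaining f, and equality in the bound forces n = (n - k) f.
module Submission where

open import Defs
open import Data.Nat using (ℕ; _*_; _+_; _≤_; _<_; _∸_)
open import Data.Nat.Divisibility using (_∣_)
open import Data.Fin using (Fin)
open import Data.Product using (Σ; _×_)
open import Relation.Binary.PropositionalEquality using (_≡_)

open import Algebra.Bundles using (CommutativeMonoid)
import Algebra.Properties.CommutativeMonoid.Sum as Sum
import Algebra.Properties.CommutativeSemigroup as CommSemigroupProperties
open import Data.Bool using (Bool; true; false; _∧_; _∨_; not)
open import Data.Bool.Properties
  using (∨-comm; ∨-zeroʳ; ∧-identityʳ; ∧-zeroʳ; ¬-not; ∧-commutativeMonoid)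
  renaming (_≟_ to _≟ᵇ_)
open import Data.Fin using (zero; suc)
open import Data.Fin.Permutation using (permutation)
open import Data.Fin.Properties using (_≟_; any?)
open import Data.Fin.Subset using (_∈_; ∣_∣)
open import Data.List using (allFin)
open import Data.List.Extrema.Nat using (argmax; f[xs]≤f[argmax])
open import Data.List.Membership.Propositional.Properties using (∈-allFin)
import Data.List.Relation.Unary.All as All
open import Data.Nat using (zero; suc; _⊓_; z≤n; s≤s)
open import Data.Nat.Divisibility using (divides)
open import Data.Nat.Properties hiding (_≟_)
open import Data.Nat.Tactic.RingSolver using (solve-∀)
open import Data.Product using (_,_)
open import Data.Sum as Sum⊎ using (_⊎_; inj₁; inj₂)
open import Data.Vec using (tabulate)
open import Data.Vec.Properties using ([]=⇒lookup; lookup⇒[]=; lookup∘tabulate)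
open import Function using (_∘_)
open import Relation.Binary.PropositionalEquality as ≡
  using (_≢_; refl; trans; cong; cong₂; module ≡-Reasoning)
open import Relation.Nullary using (yes; no; does; contradiction)
open import Relation.Nullary.Decidable using (dec-false)

open Sum +-0-commutativeMonoid using (sum; sum-cong-≗; sum-permute)
open CommSemigroupProperties (CommutativeMonoid.commutativeSemigroup ∧-commutativeMonoid)
  using (xy∙z≈xz∙y)
open CommSemigroupProperties *-commutativeSemigroup using (x∙yz≈y∙xz)

Subsetᶠ : ℕ → Set
Subsetᶠ m = Fin m → Bool

module _ {m : ℕ} where

  empty : Subsetᶠ m
  empty _ = false

  full : Subsetᶠ m
  full _ = true

  ∁ : Subsetᶠ m → Subsetᶠ m
  ∁ p x = not (p x)

  infixl 7 _∩_
  infixl 6 _∪_ _─_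

  _∩_ : Subsetᶠ m → Subsetᶠ m → Subsetᶠ m
  (p ∩ q) x = p x ∧ q x

  _∪_ : Subsetᶠ m → Subsetᶠ m → Subsetᶠ m
  (p ∪ q) x = p x ∨ q x

  ｛_｝ : Fin m → Subsetᶠ m
  ｛ u ｝ x = does (x ≟ u)

  _─_ : Subsetᶠ m → Fin m → Subsetᶠ m
  p ─ u = p ∩ ∁ ｛ u ｝

  ∈-─ : ∀ p {u x} → p x ≡ true → x ≢ u → (p ─ u) x ≡ true
  ∈-─ p {u} {x} px x≢u = cong₂ _∧_ px (cong not (dec-false (x ≟ u) x≢u))

toℕ : Bool → ℕ
toℕ false = 0
toℕ true  = 1

count : ∀ {m} → Subsetᶠ m → ℕ
count p = sum (toℕ ∘ p)

count-cong : ∀ {m} {p q : Subsetᶠ m} → (∀ x → p x ≡ q x) → count p ≡ count q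
count-cong p≗q = sum-cong-≗ (cong toℕ ∘ p≗q)

count-empty : ∀ m → count (empty {m}) ≡ 0
count-empty zero    = refl
count-empty (suc m) = count-empty m

count-full : ∀ m → count (full {m}) ≡ m
count-full zero    = refl
count-full (suc m) = cong suc (count-full m)

count-｛｝ : ∀ {m} (u : Fin m) → count ｛ u ｝ ≡ 1
count-｛｝ {suc m} zero    = cong suc (count-empty m)
count-｛｝ {suc m} (suc u) = count-｛｝ u

count-split : ∀ {m} (p q : Subsetᶠ m) → count p ≡ count (p ∩ q) + count (p ∩ ∁ q)
count-split {zero}  p q = refl
count-split {suc m} p q with p zero | q zero | count-split (p ∘ suc) (q ∘ suc)
... | false | _     | eq = eq
... | true  | true  | eq = cong suc eq
... | true  | false | eq = trans (cong suc eq) (≡.sym (+-suc _ _))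

count-∪ : ∀ {m} (p q : Subsetᶠ m) → count (p ∪ q) ≤ count p + count q
count-∪ {zero}  p q = z≤n
count-∪ {suc m} p q with p zero | q zero | count-∪ (p ∘ suc) (q ∘ suc)
... | false | false | le = le
... | false | true  | le = ≤-trans (s≤s le) (≤-reflexive (≡.sym (+-suc _ _)))
... | true  | b     | le = s≤s (≤-trans le (+-monoʳ-≤ (count (p ∘ suc)) (m≤n+m _ (toℕ b))))

count-∩≤ʳ : ∀ {m} (p q : Subsetᶠ m) → count (p ∩ q) ≤ count q
count-∩≤ʳ {zero}  p q = z≤n
count-∩≤ʳ {suc m} p q with p zero | q zero | count-∩≤ʳ (p ∘ suc) (q ∘ suc)
... | false | b     | le = ≤-trans le (m≤n+m _ (toℕ b))
... | true  | false | le = le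
... | true  | true  | le = s≤s le

count-─ : ∀ {m} (p : Subsetᶠ m) {u} → p u ≡ true → count p ≡ suc (count (p ─ u))
count-─ p {u} pu = begin
  count p                            ≡⟨ count-split p ｛ u ｝ ⟩
  count (p ∩ ｛ u ｝) + count (p ─ u) ≡⟨ cong (_+ count (p ─ u)) (count-cong p∩｛u｝≗｛u｝) ⟩
  count ｛ u ｝ + count (p ─ u)       ≡⟨ cong (_+ count (p ─ u)) (count-｛｝ u) ⟩
  suc (count (p ─ u))                ∎
  where
  open ≡-Reasoning
  p∩｛u｝≗｛u｝ : ∀ x → (p ∩ ｛ u ｝) x ≡ ｛ u ｝ x
  p∩｛u｝≗｛u｝ x with x ≟ u
  ... | yes refl = trans (∧-identityʳ (p u)) pu
  ... | no _     = ∧-zeroʳ (p x)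

count-∘-involution : ∀ {m} (σ : Fin m → Fin m) → (∀ x → σ (σ x) ≡ x) →
                     (p : Subsetᶠ m) → count (p ∘ σ) ≡ count p
count-∘-involution σ σσ p = ≡.sym (sum-permute (toℕ ∘ p) (permutation σ σ σσ σσ))

∣tabulate∣≡count : ∀ {m} (p : Subsetᶠ m) → ∣ tabulate p ∣ ≡ count p
∣tabulate∣≡count {zero}  p = refl
∣tabulate∣≡count {suc m} p with p zero
... | true  = cong suc (∣tabulate∣≡count (p ∘ suc))
... | false = ∣tabulate∣≡count (p ∘ suc)

∈-tabulate⁺ : ∀ {m} {p : Subsetᶠ m} {x} → p x ≡ true → x ∈ tabulate p
∈-tabulate⁺ {p = p} {x} px = lookup⇒[]= x (tabulate p) (trans (lookup∘tabulate p x) px)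

∈-tabulate⁻ : ∀ {m} {p : Subsetᶠ m} {x} → x ∈ tabulate p → p x ≡ true
∈-tabulate⁻ {p = p} {x} x∈p = trans (≡.sym (lookup∘tabulate p x)) ([]=⇒lookup x∈p)

module _ {m : ℕ} {G : Graph m} (M : PerfectMatching G) where

  private
    σ : Fin m → Fin m
    σ = partner M

  Closed : Subsetᶠ m → Set
  Closed R = ∀ x → R (σ x) ≡ R x

  ∩-closed : ∀ {p q} → Closed p → Closed q → Closed (p ∩ q)
  ∩-closed p-closed q-closed x = cong₂ _∧_ (p-closed x) (q-closed x)

  ∪-closed : ∀ {p q} → Closed p → Closed q → Closed (p ∪ q)
  ∪-closed p-closed q-closed x = cong₂ _∨_ (p-closed x) (q-closed x)

  ∁-closed : ∀ {p} → Closed p → Closed (∁ p)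
  ∁-closed p-closed x = cong not (p-closed x)

  record AgreesOn (M′ : PerfectMatching G) (p : Subsetᶠ m) : Set where
    constructor agreesOn
    field agreesAt : ∀ x → p x ≡ true → partner M′ x ≡ σ x

  open AgreesOn

  agreesOn-∪⁺ : ∀ {M′ p q} → AgreesOn M′ p → AgreesOn M′ q → AgreesOn M′ (p ∪ q)
  agreesOn-∪⁺ {p = p} on-p on-q .agreesAt x x∈p∪q with p x in px
  ... | true  = agreesAt on-p x px
  ... | false = agreesAt on-q x x∈p∪q

  agreesOn-∪⁻ˡ : ∀ {M′ p q} → AgreesOn M′ (p ∪ q) → AgreesOn M′ p
  agreesOn-∪⁻ˡ {q = q} on-p∪q .agreesAt x px = agreesAt on-p∪q x (cong (_∨ q x) px)

  agreesOn-∪⁻ʳ : ∀ {M′ p q} → AgreesOn M′ (p ∪ q) → AgreesOn M′ q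
  agreesOn-∪⁻ʳ {p = p} on-p∪q .agreesAt x qx =
    agreesAt on-p∪q x (trans (cong (p x ∨_) qx) (∨-zeroʳ (p x)))

  -- Relative forcing: among the perfect matchings that coincide with M outside R,
  -- M is the only one containing the edges of S.
  Forces : Subsetᶠ m → Subsetᶠ m → Set
  Forces R S = ∀ M′ → AgreesOn M′ (∁ R ∪ S) → ∀ x → partner M′ x ≡ σ x

  touchesN : Fin m → Subsetᶠ m
  touchesN u = adj G u ∪ adj G u ∘ σ

  touchesN-closed : ∀ u → Closed (touchesN u)
  touchesN-closed u x rewrite involutive M x = ∨-comm (adj G u (σ x)) (adj G u x)

  touchesN-self : ∀ u → touchesN u u ≡ true
  touchesN-self u = trans (cong (adj G u u ∨_) (adjacent M u)) (∨-zeroʳ _)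

  adj⇒touchesN : ∀ {u x} → adj G u x ≡ true → touchesN u x ≡ true
  adj⇒touchesN {u} {x} ux = cong (_∨ adj G u (σ x)) ux

  count-touchesN : ∀ u → count (touchesN u) ≤ 2 * deg G u
  count-touchesN u = begin
    count (adj G u ∪ adj G u ∘ σ)            ≤⟨ count-∪ (adj G u) (adj G u ∘ σ) ⟩
    count (adj G u) + count (adj G u ∘ σ)    ≡⟨ cong (count (adj G u) +_)
                                                  (count-∘-involution σ (involutive M) (adj G u)) ⟩
    count (adj G u) + count (adj G u)        ≡⟨ cong₂ _+_ count≡deg count≡deg ⟩
    deg G u + deg G u                        ≡⟨ cong (deg G u +_) (≡.sym (+-identityʳ _)) ⟩
    2 * deg G u                              ∎
    where
    open ≤-Reasoning
    count≡deg : count (adj G u) ≡ deg G u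
    count≡deg = ≡.sym (∣tabulate∣≡count (adj G u))

  ｛｝-σ : ∀ u x → ｛ u ｝ (σ x) ≡ ｛ σ u ｝ x
  ｛｝-σ u x with σ x ≟ u | x ≟ σ u
  ... | yes _    | yes _   = refl
  ... | no _     | no _    = refl
  ... | yes refl | no x≢σu = contradiction (≡.sym (involutive M x)) x≢σu
  ... | no σx≢u  | yes refl = contradiction (involutive M u) σx≢u

  module Round (R : Subsetᶠ m) (u : Fin m) where

    near far added : Subsetᶠ m
    near  = R ∩ touchesN u
    far   = R ∩ ∁ (touchesN u)
    added = near ─ u ─ σ u

    far-closed : Closed R → Closed far
    far-closed R-closed = ∩-closed R-closed (∁-closed (touchesN-closed u))

    added-closed : Closed R → Closed added
    added-closed R-closed x = begin
      (near (σ x) ∧ not (｛ u ｝ (σ x))) ∧ not (｛ σ u ｝ (σ x))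
        ≡⟨ cong₂ (λ a b → (near (σ x) ∧ not a) ∧ not b) (｛｝-σ u x) (｛｝-σ (σ u) x) ⟩
      (near (σ x) ∧ not (｛ σ u ｝ x)) ∧ not (｛ σ (σ u) ｝ x)
        ≡⟨ cong₂ (λ a v → (a ∧ not (｛ σ u ｝ x)) ∧ not (｛ v ｝ x))
                 (∩-closed R-closed (touchesN-closed u) x) (involutive M u) ⟩
      (near x ∧ not (｛ σ u ｝ x)) ∧ not (｛ u ｝ x)
        ≡⟨ xy∙z≈xz∙y (near x) _ _ ⟩
      (near x ∧ not (｛ u ｝ x)) ∧ not (｛ σ u ｝ x) ∎
      where open ≡-Reasoning

    ∈-added : ∀ {x} → R x ≡ true → touchesN u x ≡ true → x ≢ u → x ≢ σ u → added x ≡ true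
    ∈-added Rx ux x≢u x≢σu = ∈-─ (near ─ u) (∈-─ near (cong₂ _∧_ Rx ux) x≢u) x≢σu

    count-near : Closed R → R u ≡ true → count near ≡ 2 + count added
    count-near R-closed Ru =
      trans (count-─ near (cong₂ _∧_ Ru (touchesN-self u))) (cong suc (count-─ (near ─ u) σu∈near─u))
      where
      σu∈near─u : (near ─ u) (σ u) ≡ true
      σu∈near─u = ∈-─ near
        (cong₂ _∧_ (trans (R-closed u) Ru) (adj⇒touchesN (adjacent M u))) (no-fixed M u)

    count-far< : Closed R → R u ≡ true → count far < count R
    count-far< R-closed Ru = begin-strict
      count far              <⟨ m<n+m (count far) 0<near ⟩
      count near + count far ≡⟨ count-split R (touchesN u) ⟨
      count R                ∎
      where
      open ≤-Reasoning
      0<near : 0 < count near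
      0<near = ≤-trans (s≤s z≤n) (≤-reflexive (≡.sym (count-near R-closed Ru)))

    count-near≤ : ∀ {f} → deg G u ≤ f → count near ≤ 2 * f
    count-near≤ du≤f =
      ≤-trans (count-∩≤ʳ R (touchesN u)) (≤-trans (count-touchesN u) (*-monoʳ-≤ 2 du≤f))

    forces-added : ∀ {S} → Forces far S → Forces R (added ∪ S)
    forces-added {S} far-forces M′ agree = far-forces M′ (agreesOn-∪⁺ on-∁far on-S)
      where
      σ′ = partner M′

      on-∁R : AgreesOn M′ (∁ R)
      on-∁R = agreesOn-∪⁻ˡ agree

      on-added : AgreesOn M′ added
      on-added = agreesOn-∪⁻ˡ (agreesOn-∪⁻ʳ {p = ∁ R} agree)

      on-S : AgreesOn M′ S
      on-S = agreesOn-∪⁻ʳ (agreesOn-∪⁻ʳ {p = ∁ R} agree)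

      agreement-at-mate⇒ : σ′ (σ′ u) ≡ σ (σ′ u) → σ′ u ≡ σ u
      agreement-at-mate⇒ eq =
        trans (≡.sym (involutive M (σ′ u))) (cong σ (trans (≡.sym eq) (involutive M′ u)))

      -- Every other candidate mate of u lies outside R or in added, where M′ follows M.
      agreement-at-mate : σ′ u ≢ σ u → σ′ (σ′ u) ≡ σ (σ′ u)
      agreement-at-mate w≢σu with R (σ′ u) in Rw
      ... | false = agreesAt on-∁R _ (cong not Rw)
      ... | true  = agreesAt on-added _
                      (∈-added Rw (adj⇒touchesN (adjacent M′ u)) (no-fixed M′ u) w≢σu)

      at-u : σ′ u ≡ σ u
      at-u with σ′ u ≟ σ u
      ... | yes eq    = eq
      ... | no w≢σu   = contradiction (agreement-at-mate⇒ (agreement-at-mate w≢σu)) w≢σu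

      at-σu : σ′ (σ u) ≡ σ (σ u)
      at-σu = trans (cong σ′ (≡.sym at-u)) (trans (involutive M′ u) (≡.sym (involutive M u)))

      on-∁far : AgreesOn M′ (∁ far)
      on-∁far .agreesAt x x∉far with R x in Rx | touchesN u x in ux
      ... | false | _    = agreesAt on-∁R x (cong not Rx)
      ... | true  | false = contradiction x∉far λ ()
      ... | true  | true with x ≟ u | x ≟ σ u
      ...   | yes refl | _        = at-u
      ...   | no _     | yes refl = at-σu
      ...   | no x≢u   | no x≢σu  = agreesAt on-added x (∈-added Rx ux x≢u x≢σu)

  -- A forcing set of M relative to R found in `rounds` rounds, each settling at most
  -- 2f vertices of R.
  record Greedy (f : ℕ) (R : Subsetᶠ m) : Set where
    field
      chosen        : Subsetᶠ m
      rounds        : ℕ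
      chosen-closed : Closed chosen
      size          : count chosen + 2 * rounds ≤ count R
      cover         : count R ≤ 2 * (rounds * f)
      forces        : Forces R chosen

  open Greedy

  greedy-empty : ∀ {f R} → (∀ x → R x ≡ false) → Greedy f R
  greedy-empty {R = R} R≗∅ = record
    { chosen        = empty
    ; rounds        = 0
    ; chosen-closed = λ _ → refl
    ; size          = ≤-reflexive (trans (+-identityʳ _) (≡.sym R≡∅))
    ; cover         = ≤-reflexive (trans R≡∅ (count-empty m))
    ; forces        = forces-empty
    }
    where
    forces-empty : Forces R empty
    forces-empty M′ agree x = agreesAt (agreesOn-∪⁻ˡ {q = empty} agree) x (cong not (R≗∅ x))

    R≡∅ : count R ≡ count (empty {m})
    R≡∅ = count-cong R≗∅

  greedy-round : ∀ {f R u} → Closed R → R u ≡ true → deg G u ≤ f →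
                 Greedy f (Round.far R u) → Greedy f R
  greedy-round {f} {R} {u} R-closed Ru du≤f rest = record
    { chosen        = added ∪ chosen rest
    ; rounds        = suc (rounds rest)
    ; chosen-closed = ∪-closed (added-closed R-closed) (chosen-closed rest)
    ; size          = size′
    ; cover         = cover′
    ; forces        = forces-added (forces rest)
    }
    where
    open Round R u
    open ≤-Reasoning

    size′ : count (added ∪ chosen rest) + 2 * suc (rounds rest) ≤ count R
    size′ = begin
      count (added ∪ chosen rest) + 2 * suc (rounds rest)
        ≤⟨ +-monoˡ-≤ _ (count-∪ added (chosen rest)) ⟩
      count added + count (chosen rest) + 2 * suc (rounds rest)
        ≡⟨ regroup (count added) (count (chosen rest)) (rounds rest) ⟩
      2 + count added + (count (chosen rest) + 2 * rounds rest)
        ≤⟨ +-monoʳ-≤ (2 + count added) (size rest) ⟩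
      2 + count added + count far
        ≡⟨ cong (_+ count far) (count-near R-closed Ru) ⟨
      count near + count far
        ≡⟨ count-split R (touchesN u) ⟨
      count R ∎
      where
      regroup : ∀ a b t → a + b + 2 * suc t ≡ 2 + a + (b + 2 * t)
      regroup = solve-∀

    cover′ : count R ≤ 2 * (suc (rounds rest) * f)
    cover′ = begin
      count R                             ≡⟨ count-split R (touchesN u) ⟩
      count near + count far              ≤⟨ +-mono-≤ (count-near≤ du≤f) (cover rest) ⟩
      2 * f + 2 * (rounds rest * f)       ≡⟨ *-distribˡ-+ 2 f (rounds rest * f) ⟨
      2 * (suc (rounds rest) * f)         ∎

  module _ {f : ℕ} (light : ∀ v → deg G v ≤ f ⊎ deg G (σ v) ≤ f) where

    light-vertex : ∀ {R u₀} → Closed R → R u₀ ≡ true → Σ (Fin m) λ u → R u ≡ true × deg G u ≤ f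
    light-vertex {u₀ = u₀} R-closed Ru₀ with light u₀
    ... | inj₁ du₀≤f  = u₀ , Ru₀ , du₀≤f
    ... | inj₂ dσu₀≤f = σ u₀ , trans (R-closed u₀) Ru₀ , dσu₀≤f

    greedy : ∀ n R → Closed R → count R ≤ n → Greedy f R
    greedy n R R-closed R≤n with any? (λ x → R x ≟ᵇ true)
    ... | no R≢∅ = greedy-empty (λ x → ¬-not (λ Rx → R≢∅ (x , Rx)))
    ... | yes (_ , Ru₀) with light-vertex R-closed Ru₀
    ...   | u , Ru , du≤f = greedy-round R-closed Ru du≤f (greedy-far n R≤n)
      where
      open Round R u
      greedy-far : ∀ n → count R ≤ n → Greedy f far
      greedy-far zero    R≤0   = contradiction (<-≤-trans (count-far< R-closed Ru) R≤0) λ ()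
      greedy-far (suc n) R≤1+n =
        greedy n far (far-closed R-closed) (≤-pred (<-≤-trans (count-far< R-closed Ru) R≤1+n))

  isForcingSet-tabulate : ∀ {S} → Closed S → Forces full S → IsForcingSet M (tabulate S)
  isForcingSet-tabulate S-closed S-forces =
      (λ v v∈S → ∈-tabulate⁺ (trans (S-closed v) (∈-tabulate⁻ v∈S)))
    , (λ M′ S⊆M′ → S-forces M′ (agreesOn λ x x∈S → S⊆M′ x (∈-tabulate⁺ x∈S)))

module _ {m : ℕ} {G : Graph m} (M : PerfectMatching G) where

  minDeg : Fin m → ℕ
  minDeg v = deg G v ⊓ deg G (partner M v)

  light-below : ∀ {f} → (∀ v → minDeg v ≤ f) → ∀ v → deg G v ≤ f ⊎ deg G (partner M v) ≤ f
  light-below minDeg≤f v = Sum⊎.map below below (⊓-sel (deg G v) (deg G (partner M v)))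
    where
    below : ∀ {d} → minDeg v ≡ d → d ≤ _
    below eq = ≤-trans (≤-reflexive (≡.sym eq)) (minDeg≤f v)

n≤[n∸k]*f : ∀ {n k f} {G : Graph (2 * n)} (M : PerfectMatching G) →
            (∀ S → IsForcingSet M S → 2 * k ≤ ∣ S ∣) →
            (∀ v → deg G v ≤ f ⊎ deg G (partner M v) ≤ f) →
            n ≤ (n ∸ k) * f
n≤[n∸k]*f {n} {k} {f} M minimal light = begin
  n             ≤⟨ *-cancelˡ-≤ 2 (≤-trans (≤-reflexive (≡.sym (count-full (2 * n)))) cover) ⟩
  rounds * f    ≤⟨ *-monoˡ-≤ f rounds≤n∸k ⟩
  (n ∸ k) * f   ∎
  where
  open ≤-Reasoning
  open Greedy (greedy M light (2 * n) full (λ _ → refl) (≤-reflexive (count-full (2 * n))))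

  2k≤chosen : 2 * k ≤ count chosen
  2k≤chosen = begin
    2 * k                   ≤⟨ minimal _ (isForcingSet-tabulate M chosen-closed forces) ⟩
    ∣ tabulate chosen ∣     ≡⟨ ∣tabulate∣≡count chosen ⟩
    count chosen            ∎

  rounds≤n∸k : rounds ≤ n ∸ k
  rounds≤n∸k = m+n≤o⇒m≤o∸n rounds (*-cancelˡ-≤ 2 (begin
    2 * (rounds + k)            ≡⟨ *-distribˡ-+ 2 rounds k ⟩
    2 * rounds + 2 * k          ≤⟨ +-monoʳ-≤ (2 * rounds) 2k≤chosen ⟩
    2 * rounds + count chosen   ≡⟨ +-comm (2 * rounds) (count chosen) ⟩
    count chosen + 2 * rounds   ≤⟨ size ⟩
    count (full {2 * n})        ≡⟨ count-full (2 * n) ⟩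
    2 * n                       ∎))

2*[m⊓n]≤m+n : ∀ m n → 2 * (m ⊓ n) ≤ m + n
2*[m⊓n]≤m+n m n = +-mono-≤ (m⊓n≤m m n) (≤-trans (≤-reflexive (+-identityʳ _)) (m⊓n≤n m n))

lemma3p3 : (n k : ℕ) (G : Graph (2 * n)) (M : PerfectMatching G) →
    ForcingNumber≡ M k → k < n →
    Σ (Fin (2 * n)) (λ u → 2 * n ≤ (n ∸ k) * (deg G u + deg G (partner M u)))
    ×
    ((Σ (Fin (2 * n)) (λ u → (n ∸ k) * (deg G u + deg G (partner M u)) ≡ 2 * n) ×
      (∀ x → (n ∸ k) * (deg G x + deg G (partner M x)) ≤ 2 * n)) →
     (n ∸ k) ∣ n)
lemma3p3 zero      k G M _ ()
lemma3p3 n@(suc _) k G M (_ , minimal) _ = (w , 2n≤[n∸k]*degSum) , n∸k∣n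
  where
  f degSum : Fin (2 * n) → ℕ
  f = minDeg M
  degSum v = deg G v + deg G (partner M v)

  w : Fin (2 * n)
  w = argmax f zero (allFin (2 * n))

  n≤[n∸k]*fw : n ≤ (n ∸ k) * f w
  n≤[n∸k]*fw = n≤[n∸k]*f {k = k} M minimal
    (light-below M λ v → All.lookup (f[xs]≤f[argmax] {f = f} zero (allFin (2 * n))) (∈-allFin v))

  2[n∸k]fw≤[n∸k]*degSum : 2 * ((n ∸ k) * f w) ≤ (n ∸ k) * degSum w
  2[n∸k]fw≤[n∸k]*degSum = ≤-trans (≤-reflexive (x∙yz≈y∙xz 2 (n ∸ k) (f w)))
    (*-monoʳ-≤ (n ∸ k) (2*[m⊓n]≤m+n (deg G w) (deg G (partner M w))))

  2n≤[n∸k]*degSum : 2 * n ≤ (n ∸ k) * degSum w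
  2n≤[n∸k]*degSum = ≤-trans (*-monoʳ-≤ 2 n≤[n∸k]*fw) 2[n∸k]fw≤[n∸k]*degSum

  n∸k∣n : (Σ (Fin (2 * n)) λ u → (n ∸ k) * degSum u ≡ 2 * n) × (∀ x → (n ∸ k) * degSum x ≤ 2 * n) →
          (n ∸ k) ∣ n
  n∸k∣n (_ , at-most) =
    divides (f w) (trans (≤-antisym n≤[n∸k]*fw [n∸k]*fw≤n) (*-comm (n ∸ k) (f w)))
    where
    [n∸k]*fw≤n : (n ∸ k) * f w ≤ n
    [n∸k]*fw≤n = *-cancelˡ-≤ 2 (≤-trans 2[n∸k]fw≤[n∸k]*degSum (at-most w))
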